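{- Let $n\ge 5$ be odd. The set of $1$-factorisations returned by the procedure $\mathrm{GenP1Fs}(n)$ (described in the context) contains a representative from each isomorphism class of perfect $1$-factorisations of $K_{n,n}$.
   Context: The vertices of $K_{n,n}$ are $u_1,\dots,u_n$ and $v_1,\dots,v_n$, with an edge $u_iv_j$ for all $i,j$. A $1$-factor of a graph is a set of edges covering every vertex exactly once. A partial $1$-factorisation of a graph $G$ is a collection of pairwise disjoint $1$-factors of $G$; it is perfect if for any two distinct $1$-factors $f,f'$ in it, $f\cup f'$ forms a Hamiltonian cycle of $G$ (such $(f,f')$ is called a perfect pair). A ($1$-)factorisation is a partial $1$-factorisation covering all edges. An ordered partial $1$-factorisation $\mathcal{F}=[f_1,\dots,f_a]$ is a partial $1$-factorisation with an order on its $1$-factors; $\mathcal{F}\Vert f_{a+1}$ denotes $[f_1,\dots,f_a,f_{a+1}]$ and $\mathcal{F}^i=[f_1,\dots,f_i]$. Two ordered partial $1$-factorisations $\mathcal{F}=[f_1,\dots,f_a]$ and $\mathcal{E}=[e_1,\dots,e_a]$ are isomorphic if there are a permutation $\psi$ of $\{1,\dots,a\}$ and a permutation $\phi$ of the vertices of $K_{n,n}$ with $\phi(f_i)=e_{\psi(i)}$ for all $i$. Unordered $1$-factorisations $\mathcal{F},\mathcal{E}$ are isomorphic if some vertex permutation maps the set of $1$-factors of $\mathcal{F}$ onto that of $\mathcal{E}$. Partial order $\prec$: for distinct ordered partial $1$-factorisations $\mathcal{F}=[f_1,\dots,f_a]$, $\mathcal{E}=[e_1,\dots,e_b]$, if $f_i=e_i$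 for all $i\le\min(a,b)$ they are incomparable; otherwise let $j$ be minimal with $f_j\ne e_j$; if $j>3$ they are incomparable; if $j\le 3$, write $f_j=\{u_1x_1,\dots,u_nx_n\}$ and $e_j=\{u_1y_1,\dots,u_ny_n\}$, let $\ell$ be minimal with $x_\ell\ne y_\ell$, and set $\mathcal{F}\prec\mathcal{E}$ if $x_\ell<y_\ell$ (ordering $v_1<v_2<\dots<v_n$) and $\mathcal{E}\prec\mathcal{F}$ otherwise. $\preccurlyeq$ is the reflexive closure. An ordered partial $1$-factorisation $\mathcal{F}$ with at least $3$ factors is minimal if $\mathcal{F}^3\preccurlyeq\mathcal{E}^3$ for every ordered partial $1$-factorisation $\mathcal{E}$ isomorphic to $\mathcal{F}$. Procedure $\mathrm{AddFactor}(n,\mathcal{P},\mathcal{T})$, where $\mathcal{P}$ is an ordered perfect partial $1$-factorisation of $K_{n,n}$ and $\mathcal{T}$ a set of $1$-factors $t$ such that $\mathcal{P}\Vert t$ is perfect partial: if $|\mathcal{P}|=n$, output $\mathcal{P}$; otherwise choose an edge $e$ of $K_{n,n}$ not in any $1$-factor of $\mathcal{P}$ that lies in the fewest $1$-factors of $\mathcal{T}$, and for each $t\in\mathcal{T}$ containing $e$, let $\mathcal{T}^*$ be the set of $t^*\in\mathcal{T}$ such that $(t,t^*)$ is a perfect pair, and call $\mathrm{AddFactor}(n,\mathcal{P}\Vert t,\mathcal{T}^*)$. Procedure $\mathrm{GenP1Fs}(n)$: generate a set $\mathcal{S}$ consisting of one minimal representative of each isomorphism class of ordered perfect partial $1$-factorisations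 of $K_{n,n}$ with four $1$-factors; for each $P\in\mathcal{S}$, let $\mathcal{T}$ be the set of $1$-factors $t$ such that $P\Vert t$ is a minimal perfect partial $1$-factorisation, and call $\mathrm{AddFactor}(n,P,\mathcal{T})$; finally screen all $1$-factorisations output by $\mathrm{AddFactor}$ for isomorphism (keeping one from each isomorphism class among them) and return them. -}

module Defs where

open import Level using (0ℓ)
open import Data.Nat using (ℕ; zero; suc; _+_; _≤_; _<_; _%_)
open import Data.Nat.DivMod using (m%n<n)
open import Data.Fin using (Fin; toℕ; fromℕ<) renaming (_<_ to _<ᶠ_)
open import Data.Vec using (Vec; []; _∷_; lookup)
open import Data.List using (List; []; _∷_; length; take; _∷ʳ_) renaming (lookup to lookupL)
open import Data.List.Membership.Propositional using (_∈_)
open import Data.List.Relation.Unary.All using (All)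
open import Data.List.Relation.Unary.AllPairs using (AllPairs)
open import Data.Product using (_×_; ∃; ∃-syntax; Σ-syntax)
open import Data.Sum using (_⊎_; inj₁; inj₂)
open import Data.Empty using (⊥)
open import Relation.Nullary using (¬_)
open import Relation.Binary.PropositionalEquality using (_≡_; _≢_)
open import Function.Bundles using (_↔_; _⇔_; Inverse)

next : ∀ {m} → Fin m → Fin m
next {suc m} i = fromℕ< (m%n<n (suc (toℕ i)) (suc m))

module _ (n : ℕ) where

  Vertex : Set
  Vertex = Fin n ⊎ Fin n

  u v : Fin n → Vertex
  u = inj₁
  v = inj₂

  -- a candidate 1-factor {u_1 x_1, ..., u_n x_n} is stored as the vector (x_1,...,x_n)
  Fac : Set
  Fac = Vec (Fin n) n

  -- edge u_i v_j is written (i , j)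
  Edge : Set
  Edge = Fin n × Fin n

  EdgeIn : Edge → Fac → Set
  EdgeIn (i Data.Product., j) f = lookup f i ≡ j

  IsFactor : Fac → Set
  IsFactor f = (∀ i j → lookup f i ≡ lookup f j → i ≡ j) × (∀ j → ∃[ i ] lookup f i ≡ j)

  InFactor : Fac → Vertex → Vertex → Set
  InFactor f a b = ∃[ i ] ((a ≡ u i × b ≡ v (lookup f i)) ⊎ (a ≡ v (lookup f i) × b ≡ u i))

  Disjoint : Fac → Fac → Set
  Disjoint f g = ∀ i → lookup f i ≢ lookup g i

  -- an edge set E (symmetric relation) forms a Hamiltonian cycle of K_{n,n}:
  -- there is a cyclic ordering w_0,...,w_{2n-1} of all vertices whose consecutive pairs are exactly E
  HamCycle : (Vertex → Vertex → Set) → Set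
  HamCycle E = Σ[ w ∈ Fin (n + n) ↔ Vertex ]
    (∀ a b → E a b ⇔ (∃[ k ] ((a ≡ Inverse.to w k × b ≡ Inverse.to w (next k))
                             ⊎ (a ≡ Inverse.to w (next k) × b ≡ Inverse.to w k))))

  PerfectPair : Fac → Fac → Set
  PerfectPair f g = HamCycle (λ a b → InFactor f a b ⊎ InFactor g a b)

  -- ordered partial 1-factorisation (list = ordered)
  OPF : List Fac → Set
  OPF P = All IsFactor P × AllPairs Disjoint P

  OPPF : List Fac → Set
  OPPF P = All IsFactor P × AllPairs (λ f g → Disjoint f g × PerfectPair f g) P

  PerfectFactorisation : List Fac → Set
  PerfectFactorisation F = OPPF F × (∀ e → ∃[ f ] (f ∈ F × EdgeIn e f))

  Maps : (Vertex ↔ Vertex) → Fac → Fac → Set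
  Maps φ f e = ∀ a b → InFactor f a b ⇔ InFactor e (Inverse.to φ a) (Inverse.to φ b)

  Iso : List Fac → List Fac → Set
  Iso F E = Σ[ φ ∈ Vertex ↔ Vertex ] Σ[ ψ ∈ Fin (length F) ↔ Fin (length E) ]
              (∀ i → Maps φ (lookupL F i) (lookupL E (Inverse.to ψ i)))

  UIso : List Fac → List Fac → Set
  UIso F E = Σ[ φ ∈ Vertex ↔ Vertex ]
    ((∀ f → f ∈ F → ∃[ e ] (e ∈ E × Maps φ f e)) × (∀ e → e ∈ E → ∃[ f ] (f ∈ F × Maps φ f e)))

  LexLt : ∀ {m} → Vec (Fin n) m → Vec (Fin n) m → Set
  LexLt [] [] = ⊥
  LexLt (a ∷ as) (b ∷ bs) = a <ᶠ b ⊎ (a ≡ b × LexLt as bs)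

  -- F ≺ E: first difference at position ≤ 3 (fuel d counts the allowed positions), decided by LexLt
  Prec : ℕ → List Fac → List Fac → Set
  Prec zero _ _ = ⊥
  Prec (suc d) (x ∷ xs) (y ∷ ys) = LexLt x y ⊎ (x ≡ y × Prec d xs ys)
  Prec (suc d) _ _ = ⊥

  _≺_ : List Fac → List Fac → Set
  F ≺ E = Prec 3 F E

  _≼_ : List Fac → List Fac → Set
  F ≼ E = F ≡ E ⊎ F ≺ E

  Minimal : List Fac → Set
  Minimal F = 3 ≤ length F × (∀ E → OPF E → Iso F E → take 3 F ≼ take 3 E)

  -- cardinality comparison |{t | A t}| ≤ |{t | B t}| of sets of 1-factors
  CardLE : (Fac → Set) → (Fac → Set) → Set
  CardLE A B = Σ[ g ∈ (Fac → Fac) ]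
    ((∀ t → A t → B (g t)) × (∀ t s → A t → A s → g t ≡ g s → t ≡ s))

  Uncovered : List Fac → Edge → Set
  Uncovered P e = ∀ f → f ∈ P → ¬ EdgeIn e f

  -- the edge choices made by AddFactor (any resolution of ties)
  Chooser : Set₁
  Chooser = List Fac → (Fac → Set) → Edge

  ChooserSpec : Chooser → Set₁
  ChooserSpec ch = ∀ (P : List Fac) (T : Fac → Set) → length P < n →
    Uncovered P (ch P T) ×
    (∀ e′ → Uncovered P e′ → CardLE (λ t → T t × EdgeIn (ch P T) t) (λ t → T t × EdgeIn e′ t))

  -- AddOut ch P T F : F is output by AddFactor(n, P, T) when edges are chosen by ch
  data AddOut (ch : Chooser) : List Fac → (Fac → Set) → List Fac → Set₁ where
    done : ∀ {P T} → length P ≡ n → AddOut ch P T P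
    step : ∀ {P T F} (t : Fac) → length P < n → T t → EdgeIn (ch P T) t →
           AddOut ch (P ∷ʳ t) (λ s → T s × PerfectPair t s) F → AddOut ch P T F

  RepSet : List (List Fac) → Set
  RepSet S = (∀ P → P ∈ S → OPPF P × length P ≡ 4 × Minimal P)
           × (∀ E → OPPF E → length E ≡ 4 → ∃[ P ] (P ∈ S × Iso E P))
           × AllPairs (λ P Q → ¬ Iso P Q) S

  InitT : List Fac → Fac → Set
  InitT P t = OPPF (P ∷ʳ t) × Minimal (P ∷ʳ t)

  Output : List (List Fac) → Chooser → List Fac → Set₁
  Output S ch F = ∃[ P ] (P ∈ S × AddOut ch P (InitT P) F)

  Screened : List (List Fac) → Chooser → List (List Fac) → Set₁
  Screened S ch R = (∀ G → G ∈ R → Output S ch G)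
                  × (∀ F → Output S ch F → ∃[ G ] (G ∈ R × UIso F G))
                  × AllPairs (λ G H → ¬ UIso G H) R

module Submission where

-- Choose four distinct 1-factors of F whose representative P ∈ S has ≼-least first three
-- 1-factors among the representatives of all such choices; P is their image under a vertex
-- permutation θ. The union of two factors of F is a Hamiltonian, hence connected, cycle, so θ
-- either keeps or swaps the two sides of K_{n,n} and carries every factor of F to a 1-factor:
-- θ(F) is a perfect 1-factorisation extending P. Each extension of P by a further image is
-- minimal, because any copy of it begins with the images of four factors of F, whose
-- representative is no smaller than P. Whatever uncovered edge AddFactor picks lies in an unused
-- image, which is still a candidate; so one branch follows θ(F) and outputs it after n steps, and
-- screening keeps a 1-factorisation isomorphic to it.

open import Defs
open import Data.Bool using (Bool; true; false; not; _xor_)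
open import Data.Bool.Properties using (not-involutive; not-distribˡ-xor; not-distribʳ-xor; xor-comm)
open import Data.Empty using (⊥; ⊥-elim)
open import Data.Fin using (Fin; toℕ; fromℕ<; inject≤)
  renaming (zero to fzero; suc to fsuc; _<_ to _<ᶠ_)
open import Data.Fin.Properties using (0≢1+n; injective⇒≤; inject≤-injective; toℕ-injective; toℕ-fromℕ<;
  fromℕ<-toℕ; toℕ<n; <-cmp) renaming (<-trans to <ᶠ-trans; _≟_ to _≟ᶠ_)
open import Data.Nat using (ℕ; _≟_; zero; suc; _+_; _∸_; _≤_; _<_; _%_; s≤s; z≤n)
open import Data.Nat.DivMod using (m<n⇒m%n≡m)
open import Data.Nat.Properties using (<-trans; <-irrefl; ≤-trans; n<1+n; n≤1+n; suc-injective; +-suc; +-comm;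
  m≤n+m; m∸n+n≡m)
open import Data.Product using (_×_; _,_; proj₁; proj₂; ∃-syntax; Σ-syntax)
import Data.Product as Product
open import Data.Sum using (_⊎_; inj₁; inj₂)
import Data.Sum as Sum
open import Data.Sum.Properties using (inj₁-injective; inj₂-injective)
open import Data.Sum.Function.Propositional using (_⊎-⇔_)
open import Data.Vec using (Vec; []; _∷_; lookup; replicate) renaming (tabulate to tabulateᵛ)
open import Data.Vec.Properties using (lookup∘tabulate; tabulate∘lookup; tabulate-cong)
open import Data.List using (List; []; _∷_; _∷ʳ_; length; map; take; filter; tabulate; allFin;
  cartesianProductWith) renaming (lookup to lookupL)
open import Data.List.Properties using (length-map; length-++; map-++; map-tabulate; tabulate-lookup)
  renaming (tabulate-cong to tabulate-congˡ)
import Data.List.Extrema as Extrema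
open import Data.List.Membership.Propositional using (_∈_; _∉_)
open import Data.List.Membership.Propositional.Properties using (∈-map⁺; ∈-map⁻; ∈-++⁺ˡ; ∈-++⁺ʳ; ∈-filter⁺;
  ∈-lookup; ∈-allFin; ∈-cartesianProductWith⁺)
import Data.List.Membership.DecPropositional as DecMembership
open import Data.List.Relation.Unary.Any using (here; there)
import Data.List.Relation.Unary.Any as Any
open import Data.List.Relation.Unary.Any.Properties using (lookup-index)
open import Data.List.Relation.Unary.All using ([]; _∷_)
import Data.List.Relation.Unary.All as All
import Data.List.Relation.Unary.All.Properties as All
open import Data.List.Relation.Unary.All.Properties using (¬Any⇒All¬)
open import Data.List.Relation.Unary.AllPairs using (AllPairs; []; _∷_)
import Data.List.Relation.Unary.AllPairs as AllPairs
import Data.List.Relation.Unary.AllPairs.Properties as AllPairs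
open import Data.List.Relation.Unary.Unique.Propositional using (Unique)
import Data.List.Relation.Unary.Unique.Propositional.Properties as Unique
open import Function.Base using (id; _∘_; case_of_)
open import Function.Bundles using (_↔_; _⇔_; Inverse; Equivalence; mk⇔)
open import Function.Construct.Composition using (_⇔-∘_)
open import Function.Construct.Symmetry using (⇔-sym)
open import Function.Properties.Equivalence using (⇔-setoid)
open import Function.Properties.Inverse using (↔-refl; ↔-sym; ↔-trans)
open import Level using (0ℓ)
open import Relation.Binary.Bundles using (TotalOrder)
open import Relation.Binary.Definitions using (tri<; tri≈; tri>)
open import Relation.Binary.PropositionalEquality
import Relation.Binary.Reasoning.Setoid as SetoidReasoning
open import Relation.Nullary using (Dec; yes; no; ¬?; _×-dec_)

module _ {n : ℕ} where

  side : Vertex n → Bool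
  side (inj₁ _) = true
  side (inj₂ _) = false

  index : Vertex n → Fin n
  index (inj₁ i) = i
  index (inj₂ j) = j

  Opposite : Vertex n → Vertex n → Set
  Opposite x y = side x ≡ not (side y)

  side≡false : ∀ x → side x ≡ false → x ≡ inj₂ (index x)
  side≡false (inj₂ j) _ = refl

  -- HamCycle n E unfolds to Σ w (∀ a b → E a b ⇔ Consecutive w a b).
  Consecutive : (Fin (n + n) ↔ Vertex n) → Vertex n → Vertex n → Set
  Consecutive w a b = ∃[ k ] ((a ≡ Inverse.to w k × b ≡ Inverse.to w (next k))
                             ⊎ (a ≡ Inverse.to w (next k) × b ≡ Inverse.to w k))

  InFactor-sym : ∀ e {a b} → InFactor n e a b → InFactor n e b a
  InFactor-sym _ (i , inj₁ (p , q)) = i , inj₂ (q , p)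
  InFactor-sym _ (i , inj₂ (p , q)) = i , inj₁ (q , p)

  InFactor-sym⇔ : ∀ e {a b} → InFactor n e a b ⇔ InFactor n e b a
  InFactor-sym⇔ e = mk⇔ (InFactor-sym e) (InFactor-sym e)

  InFactor-opposite : ∀ e {a b} → InFactor n e a b → Opposite a b
  InFactor-opposite _ (i , inj₁ (refl , refl)) = refl
  InFactor-opposite _ (i , inj₂ (refl , refl)) = refl

  InFactor-u⇔ : ∀ e {i y} → InFactor n e (inj₁ i) y ⇔ (y ≡ inj₂ (lookup e i))
  InFactor-u⇔ e {i} = mk⇔ to (λ y≡ → i , inj₁ (refl , y≡))
    where
      to : ∀ {y} → InFactor n e (inj₁ i) y → y ≡ inj₂ (lookup e i)
      to (i′ , inj₁ (p , q)) rewrite inj₁-injective p = q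

  InFactor⇔EdgeIn : ∀ e {i j} → InFactor n e (inj₁ i) (inj₂ j) ⇔ EdgeIn n (i , j) e
  InFactor⇔EdgeIn e = mk⇔ (λ x → sym (inj₂-injective (Equivalence.to (InFactor-u⇔ e) x)))
                          (λ e≡ → Equivalence.from (InFactor-u⇔ e) (cong inj₂ (sym e≡)))

  Disjoint⇒¬InFactor : ∀ f g {a b} → Disjoint n f g → InFactor n f a b → InFactor n g a b → ⊥
  Disjoint⇒¬InFactor f g d (i , inj₁ (refl , refl)) y =
    d i (inj₂-injective (Equivalence.to (InFactor-u⇔ g) y))
  Disjoint⇒¬InFactor f g d (i , inj₂ (refl , refl)) y =
    d i (inj₂-injective (Equivalence.to (InFactor-u⇔ g) (InFactor-sym g y)))

  InFactor-v : ∀ e {j y} → InFactor n e (inj₂ j) y → ∃[ i ] lookup e i ≡ j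
  InFactor-v _ (i , inj₂ (p , _)) = i , sym (inj₂-injective p)

  module _ (f : Fac n) (fac : IsFactor n f) where

    partner : Vertex n → Vertex n
    partner (inj₁ i) = inj₂ (lookup f i)
    partner (inj₂ j) = inj₁ (proj₁ (proj₂ fac j))

    InFactor-partner : ∀ a → InFactor n f a (partner a)
    InFactor-partner (inj₁ i) = i , inj₁ (refl , refl)
    InFactor-partner (inj₂ j) = proj₁ (proj₂ fac j) , inj₂ (cong inj₂ (sym (proj₂ (proj₂ fac j))) , refl)

    InFactor⇒partner : ∀ {a b} → InFactor n f a b → b ≡ partner a
    InFactor⇒partner (i , inj₁ (refl , refl)) = refl
    InFactor⇒partner (i , inj₂ (refl , refl)) =
      cong inj₁ (proj₁ fac _ _ (sym (proj₂ (proj₂ fac (lookup f i)))))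

    InFactor-functional : ∀ {a b c} → InFactor n f a b → InFactor n f a c → b ≡ c
    InFactor-functional x y = trans (InFactor⇒partner x) (sym (InFactor⇒partner y))

module _ {A B : Set} (φ : A ↔ B) where
  open Inverse φ

  from-injective : ∀ {x y} → from x ≡ from y → x ≡ y
  from-injective {x} {y} p = trans (sym (strictlyInverseˡ x)) (trans (cong to p) (strictlyInverseˡ y))

  to-injective : ∀ {x y} → to x ≡ to y → x ≡ y
  to-injective {x} {y} p = trans (sym (strictlyInverseʳ x)) (trans (cong from p) (strictlyInverseʳ y))

module _ {n : ℕ} (φ : Vertex n ↔ Vertex n) where
  open Inverse φ

  Maps-sym : ∀ f e → Maps n φ f e → Maps n (↔-sym φ) e f
  Maps-sym f e m a b = mk⇔
    (λ x → Equivalence.from (m (from a) (from b))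
             (subst₂ (InFactor n e) (sym (strictlyInverseˡ a)) (sym (strictlyInverseˡ b)) x))
    (λ x → subst₂ (InFactor n e) (strictlyInverseˡ a) (strictlyInverseˡ b)
             (Equivalence.to (m (from a) (from b)) x))

  Maps⁻ : ∀ f e {x y} → Maps n φ f e → InFactor n e x y → InFactor n f (from x) (from y)
  Maps⁻ f e m = Equivalence.to (Maps-sym f e m _ _)

  Maps-unique : ∀ f {e e′} → Maps n φ f e → Maps n φ f e′ → e ≡ e′
  Maps-unique f {e} {e′} m m′ =
    trans (sym (tabulate∘lookup e)) (trans (tabulate-cong same) (tabulate∘lookup e′))
    where
      same : ∀ i → lookup e i ≡ lookup e′ i
      same i = inj₂-injective (Equivalence.to (InFactor-u⇔ e′)
        (Equivalence.from (Maps-sym f e′ m′ _ _) (Maps⁻ f e m (Equivalence.from (InFactor-u⇔ e) refl))))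

  Maps-IsFactor : ∀ f e → IsFactor n f → Maps n φ f e → IsFactor n e
  Maps-IsFactor f e fac m = injective , surjective
    where
      back : ∀ {i j} → lookup e i ≡ j → InFactor n f (from (inj₂ j)) (from (inj₁ i))
      back e≡ = InFactor-sym f (Maps⁻ f e m (Equivalence.from (InFactor-u⇔ e) (cong inj₂ (sym e≡))))

      injective : ∀ i j → lookup e i ≡ lookup e j → i ≡ j
      injective i j e≡ = inj₁-injective (from-injective φ (InFactor-functional f fac (back e≡) (back refl)))

      surjective : ∀ j → ∃[ i ] lookup e i ≡ j
      surjective j = InFactor-v e (subst (λ z → InFactor n e z (to p)) (strictlyInverseˡ (inj₂ j))
                                     (Equivalence.to (m _ _) (InFactor-partner f fac (from (inj₂ j)))))
        where p = partner f fac (from (inj₂ j))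

  Disjoint-transport : ∀ f g e e′ → Maps n φ f e → Maps n φ g e′ → Disjoint n f g → Disjoint n e e′
  Disjoint-transport f g e e′ m m′ d i e≡ = Disjoint⇒¬InFactor f g d
    (Maps⁻ f e m (Equivalence.from (InFactor-u⇔ e) refl))
    (Maps⁻ g e′ m′ (Equivalence.from (InFactor-u⇔ e′) (cong inj₂ e≡)))

  Consecutive-transport : ∀ w {a b} → Consecutive w (from a) (from b) ⇔ Consecutive (↔-trans w φ) a b
  Consecutive-transport w = mk⇔ (Product.map₂ (Sum.map (Product.map fwd fwd) (Product.map fwd fwd)))
                                (Product.map₂ (Sum.map (Product.map bwd bwd) (Product.map bwd bwd)))
    where
      fwd : ∀ {a x} → from a ≡ x → a ≡ to x
      fwd {a} p = trans (sym (strictlyInverseˡ a)) (cong to p)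
      bwd : ∀ {a x} → a ≡ to x → from a ≡ x
      bwd {x = x} p = trans (cong from p) (strictlyInverseʳ x)

  HamCycle-transport : ∀ {E E′ : Vertex n → Vertex n → Set} →
    (∀ a b → E a b ⇔ E′ (to a) (to b)) → HamCycle n E → HamCycle n E′
  HamCycle-transport {E} {E′} E⇔E′ (w , cycle) =
    ↔-trans w φ , λ a b → Consecutive-transport w ⇔-∘ (cycle (from a) (from b) ⇔-∘ E′⇔E a b)
    where
      E′⇔E : ∀ a b → E′ a b ⇔ E (from a) (from b)
      E′⇔E a b = ⇔-sym (subst₂ (λ x y → E (from a) (from b) ⇔ E′ x y)
                          (strictlyInverseˡ a) (strictlyInverseˡ b) (E⇔E′ (from a) (from b)))

  PerfectPair-transport : ∀ f g e e′ → Maps n φ f e → Maps n φ g e′ → PerfectPair n f g → PerfectPair n e e′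
  PerfectPair-transport f g e e′ m m′ = HamCycle-transport (λ a b → m a b ⊎-⇔ m′ a b)

module _ {n : ℕ} where

  PerfectPair-sym : ∀ f g → PerfectPair n f g → PerfectPair n g f
  PerfectPair-sym f g = HamCycle-transport ↔-refl (λ a b → mk⇔ Sum.swap Sum.swap)

  Disjoint-sym : ∀ f g → Disjoint n f g → Disjoint n g f
  Disjoint-sym f g d i e≡ = d i (sym e≡)

next-invariant⇒constant : ∀ {N} {A : Set} (g : Fin N → A) → (∀ k → g k ≡ g (next k)) → ∀ i j → g i ≡ g j
next-invariant⇒constant {suc N} g invariant i j = trans (reach i) (sym (reach j))
  where
    reach′ : ∀ t (t<N : t < suc N) → g (fromℕ< t<N) ≡ g fzero
    reach′ zero _ = refl
    reach′ (suc t) 1+t<N = trans (cong g (sym next≡)) (trans (sym (invariant _)) (reach′ t t<N))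
      where
        t<N = <-trans (n<1+n t) 1+t<N
        next≡ : next (fromℕ< t<N) ≡ fromℕ< 1+t<N
        next≡ = toℕ-injective (begin
          toℕ (next (fromℕ< t<N))       ≡⟨ toℕ-fromℕ< _ ⟩
          suc (toℕ (fromℕ< t<N)) % suc N ≡⟨ cong (λ z → suc z % suc N) (toℕ-fromℕ< t<N) ⟩
          suc t % suc N                  ≡⟨ m<n⇒m%n≡m 1+t<N ⟩
          suc t                          ≡⟨ toℕ-fromℕ< 1+t<N ⟨
          toℕ (fromℕ< 1+t<N)             ∎)
          where open ≡-Reasoning
    reach : ∀ k → g k ≡ g fzero
    reach k = trans (cong g (sym (fromℕ<-toℕ k (toℕ<n k)))) (reach′ (toℕ k) (toℕ<n k))

HamCycle-constant : ∀ {n} {E : Vertex n → Vertex n → Set} {A : Set} → HamCycle n E →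
  (h : Vertex n → A) → (∀ {a b} → E a b → h a ≡ h b) → ∀ x y → h x ≡ h y
HamCycle-constant (w , cycle) h along-edges x y =
  trans (cong h (sym (strictlyInverseˡ x)))
        (trans (constant (from x) (from y)) (cong h (strictlyInverseˡ y)))
  where
    open Inverse w
    constant = next-invariant⇒constant (h ∘ to)
                 (λ k → along-edges (Equivalence.from (cycle _ _) (k , inj₁ (refl , refl))))

xor-not-not : ∀ x y → not x xor not y ≡ x xor y
xor-not-not x y = begin
  not x xor not y     ≡⟨ not-distribˡ-xor x (not y) ⟨
  not (x xor not y)   ≡⟨ cong not (not-distribʳ-xor x y) ⟨
  not (not (x xor y)) ≡⟨ not-involutive _ ⟩
  x xor y             ∎
  where open ≡-Reasoning

xor-opposite : ∀ {a b c d} → c xor a ≡ d xor b → a ≡ not b → c ≡ not d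
xor-opposite {b = true}  {true}  {false} _  refl = refl
xor-opposite {b = true}  {false} {true}  _  refl = refl
xor-opposite {b = false} {true}  {false} _  refl = refl
xor-opposite {b = false} {false} {true}  _  refl = refl
xor-opposite {b = true}  {true}  {true}  () refl
xor-opposite {b = true}  {false} {false} () refl
xor-opposite {b = false} {true}  {true}  () refl
xor-opposite {b = false} {false} {false} () refl

module _ {n : ℕ} (θ : Vertex n ↔ Vertex n) where
  open Inverse θ

  flipped : Vertex n → Bool
  flipped x = side (to x) xor side x

  -- θ either keeps every vertex on its side of K_{n,n} or moves every vertex to the other side.
  SideCoherent : Set
  SideCoherent = ∀ x y → flipped x ≡ flipped y

  PerfectPair⇒SideCoherent : ∀ f g e e′ → PerfectPair n f g → Maps n θ f e → Maps n θ g e′ → SideCoherent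
  PerfectPair⇒SideCoherent f g e e′ pp m m′ = HamCycle-constant pp flipped along-edges
    where
      flipped-edge : ∀ {a b} → Opposite a b → Opposite (to a) (to b) → flipped a ≡ flipped b
      flipped-edge {a} {b} p q = trans (cong₂ _xor_ q p) (xor-not-not (side (to b)) (side b))
      along-edges : ∀ {a b} → InFactor n f a b ⊎ InFactor n g a b → flipped a ≡ flipped b
      along-edges (inj₁ x) = flipped-edge (InFactor-opposite f x) (InFactor-opposite e (Equivalence.to (m _ _) x))
      along-edges (inj₂ x) = flipped-edge (InFactor-opposite g x) (InFactor-opposite e′ (Equivalence.to (m′ _ _) x))

  module _ (coherent : SideCoherent) where

    opposite-to : ∀ {x y} → Opposite x y → Opposite (to x) (to y)
    opposite-to {x} {y} = xor-opposite (coherent x y)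

    opposite-from : ∀ {x y} → Opposite (to x) (to y) → Opposite x y
    opposite-from {x} {y} =
      xor-opposite (trans (xor-comm (side x) (side (to x))) (trans (coherent x y) (xor-comm (side (to y)) (side y))))

    module _ (f : Fac n) (fac : IsFactor n f) where

      image : Fac n
      image = tabulateᵛ λ i → index (to (partner f fac (from (inj₁ i))))

      to-partner : ∀ i → to (partner f fac (from (inj₁ i))) ≡ inj₂ (lookup image i)
      to-partner i = trans (side≡false _ opposite) (cong inj₂ (sym (lookup∘tabulate _ i)))
        where
          a = from (inj₁ i)
          opposite : Opposite (to (partner f fac a)) (inj₁ i)
          opposite = subst (Opposite _) (strictlyInverseˡ (inj₁ i))
                       (opposite-to (InFactor-opposite f (InFactor-sym f (InFactor-partner f fac a))))

      InFactor⇔to-partner : ∀ {a b i} → to a ≡ inj₁ i → InFactor n f a b ⇔ (to b ≡ inj₂ (lookup image i))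
      InFactor⇔to-partner {a} {b} {i} to-a = mk⇔
        (λ x → trans (cong to (InFactor⇒partner f fac x)) to-partner-a)
        (λ to-b → subst (InFactor n f a) (sym (to-injective θ (trans to-b (sym to-partner-a))))
                    (InFactor-partner f fac a))
        where
          to-partner-a : to (partner f fac a) ≡ inj₂ (lookup image i)
          to-partner-a = trans (cong (to ∘ partner f fac) (trans (sym (strictlyInverseʳ a)) (cong from to-a)))
                               (to-partner i)

      Maps-image : Maps n θ f image
      Maps-image a b with to a in to-a | to b in to-b
      ... | inj₁ i | w = begin
        InFactor n f a b             ≈⟨ subst (λ z → InFactor n f a b ⇔ (z ≡ inj₂ (lookup image i))) to-b
                                            (InFactor⇔to-partner to-a) ⟩
        (w ≡ inj₂ (lookup image i))  ≈⟨ InFactor-u⇔ image ⟨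
        InFactor n image (inj₁ i) w  ∎
        where open SetoidReasoning (⇔-setoid 0ℓ)
      ... | inj₂ j | inj₁ i = begin
        InFactor n f a b                  ≈⟨ InFactor-sym⇔ f ⟩
        InFactor n f b a                  ≈⟨ subst (λ z → InFactor n f b a ⇔ (z ≡ inj₂ (lookup image i))) to-a
                                                 (InFactor⇔to-partner to-b) ⟩
        (inj₂ j ≡ inj₂ (lookup image i))  ≈⟨ InFactor-u⇔ image ⟨
        InFactor n image (inj₁ i) (inj₂ j) ≈⟨ InFactor-sym⇔ image ⟩
        InFactor n image (inj₂ j) (inj₁ i) ∎
        where open SetoidReasoning (⇔-setoid 0ℓ)
      ... | inj₂ j | inj₂ j′ =
        mk⇔ (λ x → case subst₂ Opposite to-a to-b (opposite-to (InFactor-opposite f x)) of λ ())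
            (λ y → case InFactor-opposite image y of λ ())

module _ {n : ℕ} where

  LexLt-trichotomous : ∀ {k} (a b : Vec (Fin n) k) → a ≡ b ⊎ LexLt n a b ⊎ LexLt n b a
  LexLt-trichotomous [] [] = inj₁ refl
  LexLt-trichotomous (x ∷ a) (y ∷ b) with <-cmp x y
  ... | tri< x<y _ _ = inj₂ (inj₁ (inj₁ x<y))
  ... | tri> _ _ y<x = inj₂ (inj₂ (inj₁ y<x))
  ... | tri≈ _ refl _ with LexLt-trichotomous a b
  ...   | inj₁ refl        = inj₁ refl
  ...   | inj₂ (inj₁ a<b)  = inj₂ (inj₁ (inj₂ (refl , a<b)))
  ...   | inj₂ (inj₂ b<a)  = inj₂ (inj₂ (inj₂ (refl , b<a)))

  LexLt-trans : ∀ {k} (a b c : Vec (Fin n) k) → LexLt n a b → LexLt n b c → LexLt n a c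
  LexLt-trans [] [] [] () _
  LexLt-trans (x ∷ a) (y ∷ b) (z ∷ c) (inj₁ x<y)        (inj₁ y<z)        = inj₁ (<ᶠ-trans x<y y<z)
  LexLt-trans (x ∷ a) (y ∷ b) (z ∷ c) (inj₁ x<y)        (inj₂ (refl , _)) = inj₁ x<y
  LexLt-trans (x ∷ a) (y ∷ b) (z ∷ c) (inj₂ (refl , _)) (inj₁ y<z)        = inj₁ y<z
  LexLt-trans (x ∷ a) (y ∷ b) (z ∷ c) (inj₂ (refl , p)) (inj₂ (refl , q)) = inj₂ (refl , LexLt-trans a b c p q)

  Prec-trans : ∀ d (xs ys zs : List (Fac n)) → Prec n d xs ys → Prec n d ys zs → Prec n d xs zs
  Prec-trans (suc d) (x ∷ xs) (y ∷ ys) (z ∷ zs) (inj₁ x<y)        (inj₁ y<z)        =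
    inj₁ (LexLt-trans x y z x<y y<z)
  Prec-trans (suc d) (x ∷ xs) (y ∷ ys) (z ∷ zs) (inj₁ x<y)        (inj₂ (refl , _)) = inj₁ x<y
  Prec-trans (suc d) (x ∷ xs) (y ∷ ys) (z ∷ zs) (inj₂ (refl , _)) (inj₁ y<z)        = inj₁ y<z
  Prec-trans (suc d) (x ∷ xs) (y ∷ ys) (z ∷ zs) (inj₂ (refl , p)) (inj₂ (refl , q)) =
    inj₂ (refl , Prec-trans d xs ys zs p q)
  Prec-trans zero    _        _        _        ()                _
  Prec-trans (suc d) []       _        _        ()                _
  Prec-trans (suc d) (_ ∷ _)  []       _        ()                _
  Prec-trans (suc d) (_ ∷ _)  (_ ∷ _)  []       _                 ()

  Prec-trichotomous : ∀ d (xs ys : List (Fac n)) → length xs ≡ d → length ys ≡ d →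
                      xs ≡ ys ⊎ Prec n d xs ys ⊎ Prec n d ys xs
  Prec-trichotomous zero [] [] _ _ = inj₁ refl
  Prec-trichotomous (suc d) (x ∷ xs) (y ∷ ys) |xs| |ys| with LexLt-trichotomous x y
  ... | inj₂ (inj₁ x<y) = inj₂ (inj₁ (inj₁ x<y))
  ... | inj₂ (inj₂ y<x) = inj₂ (inj₂ (inj₁ y<x))
  ... | inj₁ refl with Prec-trichotomous d xs ys (suc-injective |xs|) (suc-injective |ys|)
  ...   | inj₁ refl           = inj₁ refl
  ...   | inj₂ (inj₁ xs≺ys)   = inj₂ (inj₁ (inj₂ (refl , xs≺ys)))
  ...   | inj₂ (inj₂ ys≺xs)   = inj₂ (inj₂ (inj₂ (refl , ys≺xs)))

  ≼-trans : ∀ (xs ys zs : List (Fac n)) → _≼_ n xs ys → _≼_ n ys zs → _≼_ n xs zs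
  ≼-trans xs ys zs (inj₁ refl) q           = q
  ≼-trans xs ys zs (inj₂ p)    (inj₁ refl) = inj₂ p
  ≼-trans xs ys zs (inj₂ p)    (inj₂ q)    = inj₂ (Prec-trans 3 xs ys zs p q)

  Key : Set
  Key = Fac n × Fac n × Fac n

  toList₃ : Key → List (Fac n)
  toList₃ (a , b , c) = a ∷ b ∷ c ∷ []

  _≤ᴷ_ : Key → Key → Set
  x ≤ᴷ y = _≼_ n (toList₃ x) (toList₃ y)

  ≤ᴷ-trans : ∀ x y z → x ≤ᴷ y → y ≤ᴷ z → x ≤ᴷ z
  ≤ᴷ-trans x y z = ≼-trans (toList₃ x) (toList₃ y) (toList₃ z)

  ≤ᴷ-total : ∀ x y → x ≤ᴷ y ⊎ y ≤ᴷ x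
  ≤ᴷ-total x y with Prec-trichotomous 3 (toList₃ x) (toList₃ y) refl refl
  ... | inj₁ x≡y        = inj₁ (inj₁ x≡y)
  ... | inj₂ (inj₁ x≺y) = inj₁ (inj₂ x≺y)
  ... | inj₂ (inj₂ y≺x) = inj₂ (inj₂ y≺x)

  -- A total preorder, made a total order by taking its induced equivalence as equality.
  ≤ᴷ-totalOrder : TotalOrder 0ℓ 0ℓ 0ℓ
  ≤ᴷ-totalOrder = record
    { Carrier = Key
    ; _≈_ = λ x y → x ≤ᴷ y × y ≤ᴷ x
    ; _≤_ = _≤ᴷ_
    ; isTotalOrder = record
      { isPartialOrder = record
        { isPreorder = record
          { isEquivalence = record
            { refl  = inj₁ refl , inj₁ refl
            ; sym   = Product.swap
            ; trans = λ {x} {y} {z} (x≤y , y≤x) (y≤z , z≤y) →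
                        ≤ᴷ-trans x y z x≤y y≤z , ≤ᴷ-trans z y x z≤y y≤x
            }
          ; reflexive = proj₁
          ; trans = λ {x} {y} {z} → ≤ᴷ-trans x y z
          }
        ; antisym = _,_
        }
      ; total = ≤ᴷ-total
      }
    }

module _ {n : ℕ} where

  Maps-trans : ∀ (φ ψ : Vertex n ↔ Vertex n) f e g → Maps n φ f e → Maps n ψ e g → Maps n (↔-trans φ ψ) f g
  Maps-trans φ ψ f e g m m′ a b = m′ _ _ ⇔-∘ m a b

  Iso-maps⁻ : ∀ {F E} ((φ , ψ , _) : Iso n F E) → ∀ j →
              Maps n φ (lookupL F (Inverse.from ψ j)) (lookupL E j)
  Iso-maps⁻ {F} {E} (φ , ψ , m) j =
    subst (λ z → Maps n φ (lookupL F (Inverse.from ψ j)) (lookupL E z))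
          (Inverse.strictlyInverseˡ ψ j) (m (Inverse.from ψ j))

  Iso-sym : ∀ {F E} → Iso n F E → Iso n E F
  Iso-sym {F} {E} iso@(φ , ψ , _) = ↔-sym φ , ↔-sym ψ , λ j →
    Maps-sym φ (lookupL F (Inverse.from ψ j)) (lookupL E j) (Iso-maps⁻ {F} {E} iso j)

  Iso-trans : ∀ {F E G} → Iso n F E → Iso n E G → Iso n F G
  Iso-trans {F} {E} {G} (φ , ψ , m) (φ′ , ψ′ , m′) =
    ↔-trans φ φ′ , ↔-trans ψ ψ′ , λ i →
      Maps-trans φ φ′ (lookupL F i) (lookupL E (Inverse.to ψ i)) (lookupL G (Inverse.to ψ′ (Inverse.to ψ i)))
        (m i) (m′ (Inverse.to ψ i))

  Iso-length≤ : ∀ {F E} → Iso n F E → length F ≤ length E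
  Iso-length≤ (_ , ψ , _) = injective⇒≤ (to-injective ψ)

  UIso-sym : ∀ {F E} → UIso n F E → UIso n E F
  UIso-sym {F} {E} (φ , F→E , E→F) = ↔-sym φ , E→F′ , F→E′
    where
      E→F′ : ∀ e → e ∈ E → ∃[ f ] (f ∈ F × Maps n (↔-sym φ) e f)
      E→F′ e e∈E with E→F e e∈E
      ... | f , f∈F , m = f , f∈F , Maps-sym φ f e m
      F→E′ : ∀ f → f ∈ F → ∃[ e ] (e ∈ E × Maps n (↔-sym φ) e f)
      F→E′ f f∈F with F→E f f∈F
      ... | e , e∈E , m = e , e∈E , Maps-sym φ f e m

  UIso-trans : ∀ {F E G} → UIso n F E → UIso n E G → UIso n F G
  UIso-trans {F} {E} {G} (φ , F→E , E→F) (φ′ , E→G , G→E) = ↔-trans φ φ′ , F→G , G→F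
    where
      F→G : ∀ f → f ∈ F → ∃[ g ] (g ∈ G × Maps n (↔-trans φ φ′) f g)
      F→G f f∈F with F→E f f∈F
      ... | e , e∈E , m with E→G e e∈E
      ...   | g , g∈G , m′ = g , g∈G , Maps-trans φ φ′ f e g m m′
      G→F : ∀ g → g ∈ G → ∃[ f ] (f ∈ F × Maps n (↔-trans φ φ′) f g)
      G→F g g∈G with G→E g g∈G
      ... | e , e∈E , m′ with E→F e e∈E
      ...   | f , f∈F , m = f , f∈F , Maps-trans φ φ′ f e g m m′

AllPairs-lookup : ∀ {A : Set} {R : A → A → Set} {xs} → AllPairs R xs →
                  ∀ {i j} → i <ᶠ j → R (lookupL xs i) (lookupL xs j)
AllPairs-lookup (Rx ∷ _)   {fzero}  {fsuc j} _         = All.lookup Rx (∈-lookup j)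
AllPairs-lookup (_  ∷ Rxs) {fsuc i} {fsuc j} (s≤s i<j) = AllPairs-lookup Rxs i<j

Unique-∷ʳ : ∀ {A : Set} {xs : List A} {x} → Unique xs → x ∉ xs → Unique (xs ∷ʳ x)
Unique-∷ʳ xs! x∉xs =
  AllPairs.++⁺ xs! ([] ∷ []) (All.map (λ x≢y → (x≢y ∘ sym) ∷ []) (¬Any⇒All¬ _ x∉xs))

Unique-lookup : ∀ {A : Set} {xs : List A} → Unique xs → ∀ {i j} → i ≢ j → lookupL xs i ≢ lookupL xs j
Unique-lookup xs! {i} {j} i≢j with <-cmp i j
... | tri< i<j _ _ = AllPairs-lookup xs! i<j
... | tri≈ _ i≡j _ = ⊥-elim (i≢j i≡j)
... | tri> _ _ j<i = AllPairs-lookup xs! j<i ∘ sym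

module _ {A B : Set} (g : A → B) where

  origin : ∀ xs → Fin (length (map g xs)) → A
  origin (x ∷ xs) fzero    = x
  origin (x ∷ xs) (fsuc i) = origin xs i

  lookup-map-origin : ∀ xs i → lookupL (map g xs) i ≡ g (origin xs i)
  lookup-map-origin (x ∷ xs) fzero    = refl
  lookup-map-origin (x ∷ xs) (fsuc i) = lookup-map-origin xs i

  origin-∈ : ∀ xs i → origin xs i ∈ xs
  origin-∈ (x ∷ xs) fzero    = here refl
  origin-∈ (x ∷ xs) (fsuc i) = there (origin-∈ xs i)

  origin-injective : ∀ {xs} → Unique xs → ∀ {i j} → origin xs i ≡ origin xs j → i ≡ j
  origin-injective {x ∷ xs} _              {fzero}  {fzero}  _ = refl
  origin-injective {x ∷ xs} (x∉xs ∷ _)     {fzero}  {fsuc j} p = ⊥-elim (All.lookup x∉xs (origin-∈ xs j) p)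
  origin-injective {x ∷ xs} (x∉xs ∷ _)     {fsuc i} {fzero}  p = ⊥-elim (All.lookup x∉xs (origin-∈ xs i) (sym p))
  origin-injective {x ∷ xs} (_    ∷ xs!)   {fsuc i} {fsuc j} p = cong fsuc (origin-injective xs! p)

allLists : ∀ m → ℕ → List (List (Fin m))
allLists m zero    = [] ∷ []
allLists m (suc k) = cartesianProductWith _∷_ (allFin m) (allLists m k)

∈-allLists : ∀ {m} (ks : List (Fin m)) → ks ∈ allLists m (length ks)
∈-allLists []       = here refl
∈-allLists (k ∷ ks) = ∈-cartesianProductWith⁺ _∷_ (∈-allFin k) (∈-allLists ks)

module _ {n m : ℕ} where

  PerfectFamily : (Fin m → Fac n) → Set
  PerfectFamily g = (∀ k → IsFactor n (g k))
                  × (∀ {k k′} → k ≢ k′ → Disjoint n (g k) (g k′) × PerfectPair n (g k) (g k′))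

  OPPF-map : ∀ {g} → PerfectFamily g → ∀ {ks} → Unique ks → OPPF n (map g ks)
  OPPF-map (fac , pair) ks! = All.map⁺ (All.universal fac _) , AllPairs.map⁺ (AllPairs.map pair ks!)

  PerfectFamily-transport : ∀ θ {g h} → PerfectFamily g → (∀ k → Maps n θ (g k) (h k)) → PerfectFamily h
  PerfectFamily-transport θ {g} {h} (fac , pair) m =
    (λ k → Maps-IsFactor θ (g k) (h k) (fac k) (m k)) ,
    λ {k} {k′} k≢k′ →
      Disjoint-transport θ (g k) (g k′) (h k) (h k′) (m k) (m k′) (proj₁ (pair k≢k′)) ,
      PerfectPair-transport θ (g k) (g k′) (h k) (h k′) (m k) (m k′) (proj₂ (pair k≢k′))

module _ {n : ℕ} {F : List (Fac n)} (pf : PerfectFactorisation n F) where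

  PerfectFactorisation⇒PerfectFamily : PerfectFamily (lookupL F)
  PerfectFactorisation⇒PerfectFamily = (λ k → All.lookup (proj₁ (proj₁ pf)) (∈-lookup k)) , pair
    where
      pair : ∀ {k k′} → k ≢ k′ →
             Disjoint n (lookupL F k) (lookupL F k′) × PerfectPair n (lookupL F k) (lookupL F k′)
      pair {k} {k′} k≢k′ with <-cmp k k′
      ... | tri< k<k′ _ _ = AllPairs-lookup (proj₂ (proj₁ pf)) k<k′
      ... | tri≈ _ k≡k′ _ = ⊥-elim (k≢k′ k≡k′)
      ... | tri> _ _ k′<k =
        Product.map (Disjoint-sym (lookupL F k′) (lookupL F k)) (PerfectPair-sym (lookupL F k′) (lookupL F k))
                    (AllPairs-lookup (proj₂ (proj₁ pf)) k′<k)

  edge-covered : ∀ i j → ∃[ k ] InFactor n (lookupL F k) (inj₁ i) (inj₂ j)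
  edge-covered i j with proj₂ pf (i , j)
  ... | f , f∈F , i↦j = k , Equivalence.from (InFactor⇔EdgeIn (lookupL F k))
                              (subst (EdgeIn n (i , j)) (lookup-index f∈F) i↦j)
    where k = Any.index f∈F

  opposite-covered : ∀ {a b} → Opposite a b → ∃[ k ] InFactor n (lookupL F k) a b
  opposite-covered {inj₁ i} {inj₂ j} _ = edge-covered i j
  opposite-covered {inj₂ j} {inj₁ i} _ with edge-covered i j
  ... | k , x = k , InFactor-sym (lookupL F k) x

  module _ (u₀ : Fin n) where
    open DecMembership (_≟ᶠ_ {length F}) using (_∈?_)

    -- Distinct factors of F differ at the vertex u₀.
    Unique⇒length≤n : ∀ {ks} → Unique ks → length ks ≤ n
    Unique⇒length≤n {ks} ks! = injective⇒≤ {f = at-u₀} injective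
      where
        at-u₀ : Fin (length ks) → Fin n
        at-u₀ i = lookup (lookupL F (lookupL ks i)) u₀
        injective : ∀ {i j} → at-u₀ i ≡ at-u₀ j → i ≡ j
        injective {i} {j} same with i ≟ᶠ j
        ... | yes i≡j = i≡j
        ... | no  i≢j =
          ⊥-elim (proj₁ (proj₂ PerfectFactorisation⇒PerfectFamily (Unique-lookup ks! i≢j)) u₀ same)

    Unique⇒complete : ∀ {ks} → Unique ks → length ks ≡ n → ∀ k → k ∈ ks
    Unique⇒complete {ks} ks! |ks| k with k ∈? ks
    ... | yes k∈ks = k∈ks
    ... | no  k∉ks = ⊥-elim (<-irrefl |ks| (Unique⇒length≤n (¬Any⇒All¬ ks k∉ks ∷ ks!)))

    -- The edges u₀ v_j lie in distinct factors of F.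
    n≤length : n ≤ length F
    n≤length = injective⇒≤ {f = λ j → proj₁ (edge-covered u₀ j)} λ {j} {j′} p →
      trans (sym (u₀↦ j)) (trans (cong (λ k → lookup (lookupL F k) u₀) p) (u₀↦ j′))
      where
        u₀↦ : ∀ j → lookup (lookupL F (proj₁ (edge-covered u₀ j))) u₀ ≡ j
        u₀↦ j = Equivalence.to (InFactor⇔EdgeIn (lookupL F (proj₁ (edge-covered u₀ j))))
                               (proj₂ (edge-covered u₀ j))

module Reconstruction {n : ℕ} (4≤n : 4 ≤ n)
  (S : List (List (Fac n))) (reps : RepSet n S)
  (ch : Chooser n) (chs : ChooserSpec n ch)
  (F : List (Fac n)) (pf : PerfectFactorisation n F) where

  m : ℕ
  m = length F

  factor : Fin m → Fac n
  factor = lookupL F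

  factors : PerfectFamily factor
  factors = PerfectFactorisation⇒PerfectFamily pf

  u₀ : Fin n
  u₀ = fromℕ< (≤-trans (s≤s z≤n) 4≤n)

  4≤m : 4 ≤ m
  4≤m = ≤-trans 4≤n (n≤length pf u₀)

  Quadruple : List (Fin m) → Set
  Quadruple ks = length ks ≡ 4 × Unique ks

  quadruple? : ∀ ks → Dec (Quadruple ks)
  quadruple? ks = (length ks ≟ 4) ×-dec AllPairs.allPairs? (λ k k′ → ¬? (k ≟ᶠ k′)) ks

  Represents : List (Fin m) → List (Fac n) → Set
  Represents ks P = P ∈ S × Iso n (map factor ks) P

  represent : ∀ ks → Quadruple ks → ∃[ P ] Represents ks P
  represent ks (|ks| , ks!) =
    proj₁ (proj₂ reps) (map factor ks) (OPPF-map factors ks!) (trans (length-map factor ks) |ks|)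

  -- Junk for lists shorter than three; it only arises in key for non-quadruples, which argmin never ranges over.
  first3 : List (Fac n) → Key
  first3 (a ∷ b ∷ c ∷ _) = a , b , c
  first3 _               = pad , pad , pad
    where pad = replicate n u₀

  first3-take : ∀ xs → 3 ≤ length xs → toList₃ (first3 xs) ≡ take 3 xs
  first3-take (a ∷ b ∷ c ∷ _) _ = refl
  first3-take []          ()
  first3-take (_ ∷ [])    (s≤s ())
  first3-take (_ ∷ _ ∷ []) (s≤s (s≤s ()))

  key : List (Fin m) → Key
  key ks with quadruple? ks
  ... | yes q = first3 (proj₁ (represent ks q))
  ... | no  _ = first3 []

  key-represents : ∀ ks → Quadruple ks → ∃[ P ] (Represents ks P × key ks ≡ first3 P)
  key-represents ks q with quadruple? ks
  ... | yes q′ = proj₁ (represent ks q′) , proj₂ (represent ks q′) , refl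
  ... | no ¬q  = ⊥-elim (¬q q)

  record LeastRepresentative : Set where
    field
      quad           : List (Fin m)
      quadruple      : Quadruple quad
      representative : List (Fac n)
      represents     : Represents quad representative
      least          : ∀ ks → Quadruple ks → ∃[ P ] (Represents ks P × first3 representative ≤ᴷ first3 P)

  least-representative : LeastRepresentative
  least-representative = record
    { quad = quad ; quadruple = quadruple
    ; representative = proj₁ found ; represents = proj₁ (proj₂ found) ; least = least }
    where
      open Extrema (≤ᴷ-totalOrder {n}) using (argmin; argmin-all; f[argmin]≤f[xs])
      candidates = filter quadruple? (allLists m 4)

      default : List (Fin m)
      default = tabulate (λ i → inject≤ i 4≤m)

      default-quadruple : Quadruple default
      default-quadruple = refl , Unique.tabulate⁺ (λ {i} {j} → inject≤-injective 4≤m 4≤m i j)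

      quad : List (Fin m)
      quad = argmin key default candidates

      quadruple : Quadruple quad
      quadruple = argmin-all key {P = Quadruple} default-quadruple (All.all-filter quadruple? (allLists m 4))

      minimal : All.All (λ ks → key quad ≤ᴷ key ks) candidates
      minimal = f[argmin]≤f[xs] {f = key} default candidates

      found = key-represents quad quadruple

      least : ∀ ks → Quadruple ks → ∃[ P ] (Represents ks P × first3 (proj₁ found) ≤ᴷ first3 P)
      least ks valid = P , represents′ , subst₂ _≤ᴷ_ (proj₂ (proj₂ found)) key≡ (All.lookup minimal ks∈)
        where
          P = proj₁ (key-represents ks valid)
          represents′ = proj₁ (proj₂ (key-represents ks valid))
          key≡ = proj₂ (proj₂ (key-represents ks valid))
          ks∈ : ks ∈ candidates
          ks∈ = ∈-filter⁺ quadruple? (subst (λ l → ks ∈ allLists m l) (proj₁ valid) (∈-allLists ks)) valid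

  open LeastRepresentative least-representative

  representative-facts : OPPF n representative × length representative ≡ 4 × Minimal n representative
  representative-facts = proj₁ reps representative (proj₁ represents)

  Drawn : List (Fac n) → Set
  Drawn E = Σ[ θ ∈ Vertex n ↔ Vertex n ] Σ[ κ ∈ (Fin (length E) → Fin m) ]
              ((∀ {i j} → κ i ≡ κ j → i ≡ j) × (∀ i → Maps n θ (factor (κ i)) (lookupL E i)))

  Drawn-map : ∀ θ {g} → (∀ k → Maps n θ (factor k) (g k)) → ∀ {ks} → Unique ks → Drawn (map g ks)
  Drawn-map θ {g} maps {ks} ks! = θ , origin g ks , origin-injective g ks! , λ i →
    subst (Maps n θ (factor (origin g ks i))) (sym (lookup-map-origin g ks i)) (maps (origin g ks i))

  Drawn-Iso : ∀ {X E} → Drawn X → Iso n X E → Drawn E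
  Drawn-Iso {X} {E} (θ , κ , κ-injective , maps) iso@(φ , ψ , _) =
    ↔-trans θ φ , κ ∘ Inverse.from ψ , from-injective ψ ∘ κ-injective , λ j →
      Maps-trans θ φ (factor (κ (Inverse.from ψ j))) (lookupL X (Inverse.from ψ j)) (lookupL E j)
        (maps (Inverse.from ψ j)) (Iso-maps⁻ {F = X} {E = E} iso j)

  least-bound : ∀ {E} → OPF n E → Drawn E → 4 ≤ length E → _≼_ n (take 3 representative) (take 3 E)
  least-bound {e₀ ∷ e₁ ∷ e₂ ∷ e₃ ∷ E} (facs , disjoint) (θ , κ , κ-injective , maps) 4≤ =
    ≼-trans (take 3 representative) (take 3 P′) (take 3 E₄)
      (subst₂ (_≼_ n) (first3-take representative (proj₁ (proj₂ (proj₂ representative-facts))))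
                      (first3-take P′ (proj₁ P′-minimal)) rep≤P′)
      (proj₂ P′-minimal E₄ (All.take⁺ 4 facs , AllPairs.take⁺ 4 disjoint)
        (Iso-trans {F = P′} {E = map factor ks} {G = E₄}
          (Iso-sym {F = map factor ks} {E = P′} P′-iso) (θ , ↔-refl , E₄-maps)))
    where
      E₄ = e₀ ∷ e₁ ∷ e₂ ∷ e₃ ∷ []

      ks : List (Fin m)
      ks = tabulate (λ i → κ (inject≤ i 4≤))

      quadruple-ks : Quadruple ks
      quadruple-ks = refl , Unique.tabulate⁺ (λ {i} {j} → inject≤-injective 4≤ 4≤ i j ∘ κ-injective)

      found = least ks quadruple-ks
      P′ = proj₁ found
      P′-iso = proj₂ (proj₁ (proj₂ found))
      rep≤P′ = proj₂ (proj₂ found)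
      P′-minimal = proj₂ (proj₂ (proj₁ reps P′ (proj₁ (proj₁ (proj₂ found)))))

      E₄-maps : ∀ i → Maps n θ (lookupL (map factor ks) i) (lookupL E₄ i)
      E₄-maps fzero                      = maps fzero
      E₄-maps (fsuc fzero)               = maps (fsuc fzero)
      E₄-maps (fsuc (fsuc fzero))        = maps (fsuc (fsuc fzero))
      E₄-maps (fsuc (fsuc (fsuc fzero))) = maps (fsuc (fsuc (fsuc fzero)))
  least-bound {[]}                    _ _ ()
  least-bound {_ ∷ []}                _ _ (s≤s ())
  least-bound {_ ∷ _ ∷ []}            _ _ (s≤s (s≤s ()))
  least-bound {_ ∷ _ ∷ _ ∷ []}        _ _ (s≤s (s≤s (s≤s ())))

  Drawn-minimal : ∀ {X} → Drawn X → 4 ≤ length X → take 3 X ≡ take 3 representative → Minimal n X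
  Drawn-minimal {X} drawn 4≤X take≡ = ≤-trans (n≤1+n 3) 4≤X , λ E opf iso →
    subst (λ l → _≼_ n l (take 3 E)) (sym take≡)
      (least-bound opf (Drawn-Iso {X} {E} drawn iso) (≤-trans 4≤X (Iso-length≤ {F = X} {E = E} iso)))

  module Run (θ : Vertex n ↔ Vertex n) (coherent : SideCoherent θ) where
    open Inverse θ using (to; from; strictlyInverseˡ)

    img : Fin m → Fac n
    img k = image θ coherent (factor k) (proj₁ factors k)

    img-maps : ∀ k → Maps n θ (factor k) (img k)
    img-maps k = Maps-image θ coherent (factor k) (proj₁ factors k)

    images : PerfectFamily img
    images = PerfectFamily-transport θ {factor} {img} factors img-maps

    images-cover : ∀ e → ∃[ k ] EdgeIn n e (img k)
    images-cover (i , j) with opposite-covered pf opposite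
      where
        opposite : Opposite (from (inj₁ i)) (from (inj₂ j))
        opposite = opposite-from θ coherent
          (subst₂ Opposite (sym (strictlyInverseˡ (inj₁ i))) (sym (strictlyInverseˡ (inj₂ j))) refl)
    ... | k , x = k , Equivalence.to (InFactor⇔EdgeIn (img k))
      (subst₂ (InFactor n (img k)) (strictlyInverseˡ (inj₁ i)) (strictlyInverseˡ (inj₂ j))
        (Equivalence.to (img-maps k _ _) x))

    UIso-images : ∀ {ks} → (∀ k → k ∈ ks) → UIso n F (map img ks)
    UIso-images {ks} complete = θ , F→images , images→F
      where
        F→images : ∀ f → f ∈ F → ∃[ e ] (e ∈ map img ks × Maps n θ f e)
        F→images f f∈F =
          img k , ∈-map⁺ img (complete k) , subst (λ g → Maps n θ g (img k)) (sym (lookup-index f∈F)) (img-maps k)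
          where k = Any.index f∈F
        images→F : ∀ e → e ∈ map img ks → ∃[ f ] (f ∈ F × Maps n θ f e)
        images→F e e∈ with ∈-map⁻ img e∈
        ... | k , _ , refl = factor k , ∈-lookup k , img-maps k

    -- The current factors are the images of ps and every unused image is still a candidate in T.
    -- Of the choice of edge only its being uncovered matters: it lies in an unused image.
    run : ∀ d ps (T : Fac n → Set) → Unique ps → d + length ps ≡ n → (∀ k → k ∉ ps → T (img k)) →
          ∃[ Out ] (AddOut n ch (map img ps) T Out × UIso n F Out)
    run zero ps T ps! |ps| _ =
      map img ps , done (trans (length-map img ps) |ps|) , UIso-images (Unique⇒complete pf u₀ ps! |ps|)
    run (suc d) ps T ps! |ps| available with images-cover (ch (map img ps) T)
    ... | k , k-covers =
      Out , step (img k) short (available k k∉ps) k-covers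
              (subst (λ Q → AddOut n ch Q T′ Out) (map-++ img ps (k ∷ [])) out) , F≅Out
      where
        short : length (map img ps) < n
        short = subst (_< n) (sym (length-map img ps)) (subst (length ps <_) |ps| (s≤s (m≤n+m (length ps) d)))

        k∉ps : k ∉ ps
        k∉ps k∈ps = proj₁ (chs (map img ps) T short) (img k) (∈-map⁺ img k∈ps) k-covers

        T′ : Fac n → Set
        T′ s = T s × PerfectPair n (img k) s

        available′ : ∀ k′ → k′ ∉ ps ∷ʳ k → T′ (img k′)
        available′ k′ k′∉ =
          available k′ (k′∉ ∘ ∈-++⁺ˡ) , proj₂ (proj₂ images (λ k≡k′ → k′∉ (∈-++⁺ʳ ps (here (sym k≡k′)))))

        |ps∷ʳk| : d + length (ps ∷ʳ k) ≡ n
        |ps∷ʳk| = begin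
          d + length (ps ∷ʳ k)  ≡⟨ cong (d +_) (length-++ ps) ⟩
          d + (length ps + 1)   ≡⟨ cong (d +_) (+-comm (length ps) 1) ⟩
          d + suc (length ps)   ≡⟨ +-suc d (length ps) ⟩
          suc d + length ps     ≡⟨ |ps| ⟩
          n                     ∎
          where open ≡-Reasoning

        result = run d (ps ∷ʳ k) T′ (Unique-∷ʳ ps! k∉ps) |ps∷ʳk| available′
        Out = proj₁ result
        out = proj₁ (proj₂ result)
        F≅Out = proj₂ (proj₂ result)

  reconstruct : ∀ P → Drawn P → length P ≡ 4 → take 3 P ≡ take 3 representative →
                ∃[ Out ] (AddOut n ch P (InitT n P) Out × UIso n F Out)
  reconstruct P@(p₀ ∷ p₁ ∷ p₂ ∷ p₃ ∷ []) (θ , κ , κ-injective , maps) refl take≡ =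
    Out , subst (λ Q → AddOut n ch Q (InitT n P) Out) (sym P≡) out , F≅Out
    where
      coherent : SideCoherent θ
      coherent = PerfectPair⇒SideCoherent θ (factor (κ fzero)) (factor (κ (fsuc fzero))) p₀ p₁
        (proj₂ (proj₂ factors (0≢1+n ∘ κ-injective))) (maps fzero) (maps (fsuc fzero))

      open Run θ coherent

      ps₀ : List (Fin m)
      ps₀ = tabulate κ

      P≡ : P ≡ map img ps₀
      P≡ = begin
        P                    ≡⟨ tabulate-lookup P ⟨
        tabulate (lookupL P) ≡⟨ tabulate-congˡ {f = lookupL P} {g = img ∘ κ}
                                  (λ i → Maps-unique θ (factor (κ i)) (maps i) (img-maps (κ i))) ⟩
        tabulate (img ∘ κ)   ≡⟨ map-tabulate κ img ⟨
        map img ps₀          ∎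
        where open ≡-Reasoning

      ps₀! : Unique ps₀
      ps₀! = Unique.tabulate⁺ κ-injective

      initial : ∀ k → k ∉ ps₀ → InitT n P (img k)
      initial k k∉ps₀ =
        subst (OPPF n) (sym X≡) (OPPF-map images unique) ,
        Drawn-minimal (subst Drawn (sym X≡) (Drawn-map θ img-maps unique)) (s≤s (s≤s (s≤s (s≤s z≤n)))) take≡
        where
          unique = Unique-∷ʳ ps₀! k∉ps₀
          X≡ : P ∷ʳ img k ≡ map img (ps₀ ∷ʳ k)
          X≡ = trans (cong (_∷ʳ img k) P≡) (sym (map-++ img ps₀ (k ∷ [])))

      result = run (n ∸ 4) ps₀ (InitT n P) ps₀! (m∸n+n≡m 4≤n) initial
      Out = proj₁ result
      out = proj₁ (proj₂ result)
      F≅Out = proj₂ (proj₂ result)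

  reconstruction : ∃[ Out ] (Output n S ch Out × UIso n F Out)
  reconstruction =
    proj₁ result , (representative , proj₁ represents , proj₁ (proj₂ result)) , proj₂ (proj₂ result)
    where
      drawn : Drawn representative
      drawn = Drawn-Iso {map factor quad} {representative}
                (Drawn-map ↔-refl {factor} (λ k a b → mk⇔ id id) (proj₂ quadruple)) (proj₂ represents)
      result = reconstruct representative drawn (proj₁ (proj₂ representative-facts)) refl

lemma2 : (n : ℕ) → 5 ≤ n → n % 2 ≡ 1 →
    (S : List (List (Fac n))) → RepSet n S →
    (ch : Chooser n) → ChooserSpec n ch →
    (R : List (List (Fac n))) → Screened n S ch R →
    (F : List (Fac n)) → PerfectFactorisation n F →
    ∃[ G ] (G ∈ R × UIso n G F)
lemma2 n 5≤n _ S reps ch chs R (_ , screened , _) F pf =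
  G , G∈R , UIso-sym {F = F} {E = G} (UIso-trans {F = F} {E = Out} {G = G} F≅Out Out≅G)
  where
    reconstruction = Reconstruction.reconstruction (≤-trans (n≤1+n 4) 5≤n) S reps ch chs F pf
    Out = proj₁ reconstruction
    F≅Out = proj₂ (proj₂ reconstruction)
    screening = screened Out (proj₁ (proj₂ reconstruction))
    G = proj₁ screening
    G∈R = proj₁ (proj₂ screening)
    Out≅G = proj₂ (proj₂ screening)
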